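{- Let $b\ge 2$ be an integer and let $L^*(b,b,b)$ be the vector game on $\mathbb{N}^2$ defined by the set of moves $\{(-b,0),(0,-b),(-1,1),(-2,2),\ldots,(-b,b)\}$. Then the horizontal component of the period of $L^*(b,b,b)$ is $b+2$.
   Context: The vector game defined by a set $S\subseteq\mathbb{Z}^2$ is the impartial normal-play game on positions in $\mathbb{N}^2$ where a move consists of adding an element of $S$ to the current position, provided the result lies in $\mathbb{N}^2$. $\mathcal{SG}(x,y)$ denotes the Sprague–Grundy value of $(x,y)$. The horizontal component of the period is the least positive integer $p$ with $\mathcal{SG}(x+p,y)=\mathcal{SG}(x,y)$ for all sufficiently large $x$ and all $y$. -}

module Defs where

open import Data.Nat using (ℕ; zero; suc; _+_; _*_; _∸_; _≤_; _<_; _≟_)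
open import Data.Integer as ℤ using (ℤ; +_; -[1+_])
open import Data.List using (List; []; _∷_; map; length; upTo; _++_)
open import Data.Product using (_×_; _,_; Σ; ∃; ∃-syntax)
open import Data.Bool using (Bool; true; false; if_then_else_)
open import Relation.Nullary using (¬_; does)

Move : Set
Move = ℤ × ℤ

addℕ : ℕ → ℤ → List ℕ
addℕ n (+ d) = (n + d) ∷ []
addℕ n -[1+ d ] with suc d Data.Nat.≤ᵇ n
... | true  = (n ∸ suc d) ∷ []
... | false = []
  where open import Data.Nat using (_≤ᵇ_)

options : List Move → ℕ → ℕ → List (ℕ × ℕ)
options [] x y = []
options ((dx , dy) ∷ S) x y = pairs (addℕ x dx) (addℕ y dy) ++ options S x y
  where
  pairs : List ℕ → List ℕ → List (ℕ × ℕ)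
  pairs [] _ = []
  pairs (a ∷ _) [] = []
  pairs (a ∷ _) (c ∷ _) = (a , c) ∷ []

elem : ℕ → List ℕ → Bool
elem n [] = false
elem n (m ∷ l) = if does (n ≟ m) then true else elem n l

-- minimum excludant: the least natural number not in the list
-- (it is at most the length of the list, so this bounded search is exact)
mex : List ℕ → ℕ
mex l = search (suc (length l)) 0
  where
  search : ℕ → ℕ → ℕ
  search zero n = n
  search (suc k) n = if elem n l then search k (suc n) else n

sgFuel : List Move → ℕ → ℕ → ℕ → ℕ
sgFuel S zero x y = 0
sgFuel S (suc f) x y = mex (go (options S x y))
  where
  go : List (ℕ × ℕ) → List ℕ
  go [] = []
  go ((x' , y') ∷ ps) = sgFuel S f x' y' ∷ go ps

Lstar : ℕ → List Move
Lstar b = (ℤ.- (+ b) , + 0) ∷ (+ 0 , ℤ.- (+ b)) ∷ map (λ k → (ℤ.- (+ suc k) , + suc k)) (upTo b)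

-- Every move of L*(b,b,b) (b ≥ 1) strictly decreases the measure
--   μ(x,y) = (x+y)*(x+y+2) + x
-- (the (-k,k) moves keep x+y and decrease x; the other two decrease x+y),
-- so fuel μ(x,y)+1 suffices for the recursion to reach terminal positions:
-- SGL b x y is the genuine Sprague–Grundy value of (x,y) in L*(b,b,b).
measure : ℕ → ℕ → ℕ
measure x y = (x + y) * (x + y + 2) + x

SGL : ℕ → ℕ → ℕ → ℕ
SGL b x y = sgFuel (Lstar b) (suc (measure x y)) x y

IsHorizPeriod : (ℕ → ℕ → ℕ) → ℕ → Set
IsHorizPeriod g p = ∃[ N ] (∀ x y → N ≤ x → g (x + p) y ≡ g x y)
  where open import Relation.Binary.PropositionalEquality using (_≡_)

HorizPeriodComponent : (ℕ → ℕ → ℕ) → ℕ → Set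
HorizPeriodComponent g p =
  (0 < p) × IsHorizPeriod g p × (∀ q → 0 < q → q < p → ¬ IsHorizPeriod g q)

-- Write x ≡ 2h + d (mod b + 2) with d ∈ {0,1}, and y = qb + s with s < b; let c be the parity of q
-- and t say whether s = b - 1.  Then SG(x,y) = 2h + ((d ∧ ¬t) ⊕ c), which is (b+2)-periodic in x and
-- equals x mod (b + 2) on the row y = 0, so no smaller period exists.  The formula obeys the mex
-- recursion.  A move (-b,0) or (-k,k) changes h, except (-1,1) from odd d, which flips the low bit,
-- as (0,-b) does by flipping c.  Conversely, each value 2h' + e with h' < h is reached by one of two
-- moves with complementary low bits: the diagonal moves to residues 2h' + 1 and 2h', or, when the
-- latter is out of reach, (-b,0) and (-b,b); and from value 2h + 1 the value 2h is reached by
-- (-1,1) or (0,-b).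

{-# OPTIONS --safe #-}
module Submission where

open import Defs
open import Data.Nat using (ℕ; zero; suc; _+_; _*_; _≤_; _<_; _≟_; _≤?_; z≤n; s≤s; z<s; _≤ᵇ_; NonZero)
open import Data.Nat.DivMod using (_/_; _%_; m≡m%n+[m/n]*n; m%n<n)
open import Data.Nat.Properties
open import Data.Nat.Tactic.RingSolver using (solve-∀)
open import Data.Integer as ℤ using (-[1+_])
open import Data.Fin using (Fin; toℕ)
open import Data.Fin.Properties using (toℕ<n; toℕ-injective; injective⇒≤)
open import Data.List using (List; []; _∷_; [_]; length; map; lookup; upTo)
open import Data.List.Properties using (foldr-universal; map-is-foldr)
open import Data.List.Membership.Propositional using (_∈_; _∉_)
open import Data.List.Membership.Propositional.Properties using (∈-map⁺; ∈-map⁻; ∈-upTo⁺; ∈-upTo⁻)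
open import Data.List.Membership.DecPropositional _≟_ using (_∈?_)
open import Data.List.Relation.Unary.Any using (here; there; index)
open import Data.List.Relation.Unary.Any.Properties using (lookup-index)
open import Data.Bool using (Bool; true; false; not; _∧_; _xor_; if_then_else_; T)
open import Data.Bool.Properties using (not-involutive; not-¬; not-distribˡ-xor; not-distribʳ-xor; ∧-identityʳ; xor-identityʳ)
open import Data.Product using (_×_; _,_; proj₁; proj₂; ∃; ∃₂; uncurry; map₁; map₂)
open import Data.Sum using (_⊎_; inj₁; inj₂)
open import Relation.Binary.Definitions using (tri<; tri≈; tri>)
open import Relation.Nullary using (¬_; does; yes; no; contradiction)
open import Relation.Binary.PropositionalEquality
  using (_≡_; _≢_; refl; sym; trans; cong; subst; ≢-sym; module ≡-Reasoning)

-- The mex recursion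

elem≡does-∈? : ∀ n l → elem n l ≡ does (n ∈? l)
elem≡does-∈? n [] = refl
elem≡does-∈? n (m ∷ l) with does (n ≟ m)
... | true = refl
... | false = elem≡does-∈? n l

module _ (l : List ℕ) (search : ℕ → ℕ → ℕ)
  (search-zero : ∀ n → search 0 n ≡ n)
  (search-suc : ∀ k n → search (suc k) n ≡ (if elem n l then search k (suc n) else n)) where

  search-finds : ∀ {v} k n → n ≤ v → v ≤ n + k → (∀ u → n ≤ u → u < v → u ∈ l) → v ∉ l →
                 search k n ≡ v
  search-finds {v} zero n n≤v v≤n+0 _ _ =
    trans (search-zero n) (≤-antisym n≤v (subst (v ≤_) (+-identityʳ n) v≤n+0))
  search-finds {v} (suc k) n n≤v v≤n+1+k below v∉l
    rewrite search-suc k n | elem≡does-∈? n l with n ∈? l | m≤n⇒m<n∨m≡n n≤v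
  ... | yes n∈l | inj₂ refl = contradiction n∈l v∉l
  ... | yes _   | inj₁ n<v = search-finds k (suc n) n<v (subst (v ≤_) (+-suc n k) v≤n+1+k)
                               (λ u n<u → below u (<⇒≤ n<u)) v∉l
  ... | no _    | inj₂ n≡v = n≡v
  ... | no n∉l  | inj₁ n<v = contradiction (below n ≤-refl n<v) n∉l

≤-length : ∀ {v l} → (∀ u → u < v → u ∈ l) → v ≤ length l
≤-length {v} {l} below = injective⇒≤ {f = position} position-injective
  where
  position : Fin v → Fin (length l)
  position i = index (below (toℕ i) (toℕ<n i))
  position-injective : ∀ {i j} → position i ≡ position j → i ≡ j
  position-injective {i} {j} eq = toℕ-injective (begin
    toℕ i                  ≡⟨ lookup-index (below (toℕ i) (toℕ<n i)) ⟩
    lookup l (position i)  ≡⟨ cong (lookup l) eq ⟩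
    lookup l (position j)  ≡⟨ lookup-index (below (toℕ j) (toℕ<n j)) ⟨
    toℕ j                  ∎)
    where open ≡-Reasoning

-- mex and sgFuel call helpers (`search`, `go`) that are local to Defs and cannot be named.
-- Once the right subterms are abstracted (the arguments of `search`; the list of options and
-- the function `elem` that inspects the output of `go`), these helpers occur rigidly in the
-- unfolded goal, and unification solves the metavariables `loop` and `go` below with them.
mex-≡ : ∀ {v l} → (∀ u → u < v → u ∈ l) → v ∉ l → mex l ≡ v
mex-≡ {v} {l} below v∉l =
  trans unfold-loop (search-finds l loop (λ _ → refl) (λ _ _ → refl) (suc (length l)) 0
                       z≤n (m≤n⇒m≤1+n (≤-length below)) (λ u _ → below u) v∉l)
  where
  loop : ℕ → ℕ → ℕ
  loop = _
  unfold-loop : mex l ≡ (if elem 0 l then loop (length l) 1 else 0)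
  unfold-loop with length l | 1
  ... | _ | _ = refl

sgFuel-suc : ∀ S f x y → sgFuel S (suc f) x y ≡ mex (map (uncurry (sgFuel S f)) (options S x y))
sgFuel-suc S f x y = trans unfold-go (cong mex (go≗map (options S x y)))
  where
  go : List (ℕ × ℕ) → List ℕ
  go = _
  unfold-go : sgFuel S (suc f) x y ≡ mex (go (options S x y))
  unfold-go with options S x y | elem
  ... | _ | _ = refl
  go≗map : ∀ ps → go ps ≡ map (uncurry (sgFuel S f)) ps
  go≗map ps = trans (foldr-universal go _ _ refl (λ _ _ → refl) ps) (sym (map-is-foldr ps))

module GrundyCharacterisation
  (S : List Move) (μ : ℕ → ℕ → ℕ)
  (μ-decreasing : ∀ {x y x' y'} → (x' , y') ∈ options S x y → μ x' y' < μ x y)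
  (Value : ℕ → ℕ → ℕ → Set)
  (value-avoided : ∀ {x y v x' y'} → Value x y v → (x' , y') ∈ options S x y →
                   ∃ λ v' → v' ≢ v × Value x' y' v')
  (smaller-values-reached : ∀ {x y v u} → Value x y v → u < v →
                            ∃₂ λ x' y' → (x' , y') ∈ options S x y × Value x' y' u)
  where

  sgFuel-≡ : ∀ {F x y v} → μ x y < F → Value x y v → sgFuel S F x y ≡ v
  sgFuel-≡ {suc F} {x} {y} {v} μ<F xy↦v = trans (sgFuel-suc S F x y) (mex-≡ below v∉)
    where
    g : ℕ × ℕ → ℕ
    g = uncurry (sgFuel S F)
    ops : List (ℕ × ℕ)
    ops = options S x y
    option-value : ∀ {x' y' v'} → (x' , y') ∈ ops → Value x' y' v' → sgFuel S F x' y' ≡ v'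
    option-value o = sgFuel-≡ (<-≤-trans (μ-decreasing o) (≤-pred μ<F))
    below : ∀ u → u < v → u ∈ map g ops
    below u u<v with smaller-values-reached xy↦v u<v
    ... | x' , y' , o , ↦u = subst (_∈ map g ops) (option-value o ↦u) (∈-map⁺ g o)
    v∉ : v ∉ map g ops
    v∉ v∈ with ∈-map⁻ g v∈
    ... | _ , o , v≡ with value-avoided xy↦v o
    ... | v' , v'≢v , ↦v' = v'≢v (trans (sym (option-value o ↦v')) (sym v≡))

-- Options and moves of L*(b,b,b)

∈-options⁻ : ∀ S {x y x' y'} → (x' , y') ∈ options S x y →
             ∃ λ m → m ∈ S × x' ∈ addℕ x (proj₁ m) × y' ∈ addℕ y (proj₂ m)
∈-options⁻ ((dx , dy) ∷ S) {x} {y} o with addℕ x dx in x+dx | addℕ y dy in y+dy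
... | []    | _     = map₂ (map₁ there) (∈-options⁻ S o)
... | _ ∷ _ | []    = map₂ (map₁ there) (∈-options⁻ S o)
∈-options⁻ ((dx , dy) ∷ S) (here refl) | a ∷ _ | c ∷ _ =
  (dx , dy) , here refl , subst (a ∈_) (sym x+dx) (here refl) , subst (c ∈_) (sym y+dy) (here refl)
∈-options⁻ ((dx , dy) ∷ S) (there o) | _ ∷ _ | _ ∷ _ = map₂ (map₁ there) (∈-options⁻ S o)

∈-options⁺ : ∀ S {x y x' y' m} → m ∈ S → addℕ x (proj₁ m) ≡ [ x' ] → addℕ y (proj₂ m) ≡ [ y' ] →
             (x' , y') ∈ options S x y
∈-options⁺ ((dx , dy) ∷ S) (here refl) x+dx y+dy rewrite x+dx | y+dy = here refl
∈-options⁺ ((dx , dy) ∷ S) {x} {y} (there m∈S) x+dx y+dy with addℕ x dx | addℕ y dy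
... | []    | _     = ∈-options⁺ S m∈S x+dx y+dy
... | _ ∷ _ | []    = ∈-options⁺ S m∈S x+dx y+dy
... | _ ∷ _ | _ ∷ _ = there (∈-options⁺ S m∈S x+dx y+dy)

∈-addℕ⁺ : ∀ n e {a} → a ∈ addℕ n (ℤ.+ e) → a ≡ n + e
∈-addℕ⁺ n e (here refl) = refl

∈-addℕ⁻ : ∀ {n e a} → a ∈ addℕ n -[1+ e ] → a + suc e ≡ n
∈-addℕ⁻ {n} {e} a∈ with suc e ≤ᵇ n in e<n
∈-addℕ⁻ (here refl) | true = m∸n+n≡m (≤ᵇ⇒≤ _ _ (subst T (sym e<n) _))

addℕ⁻-≡ : ∀ {n e a} → a + suc e ≡ n → addℕ n -[1+ e ] ≡ [ a ]
addℕ⁻-≡ {n} {e} {a} refl with suc e ≤ᵇ a + suc e in e<n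
... | true  = cong [_] (m+n∸n≡m a (suc e))
... | false = contradiction (≤⇒≤ᵇ (m≤n+m (suc e) a)) (subst T e<n)

data LstarMove (b x y : ℕ) : ℕ → ℕ → Set where
  horizontal : ∀ {x'} → x' + b ≡ x → LstarMove b x y x' y
  vertical   : ∀ {y'} → y' + b ≡ y → LstarMove b x y x y'
  diagonal   : ∀ {x' k} → 1 ≤ k → k ≤ b → x' + k ≡ x → LstarMove b x y x' (y + k)

∈-options-Lstar⁻ : ∀ {b x y x' y'} → (x' , y') ∈ options (Lstar (suc b)) x y → LstarMove (suc b) x y x' y'
∈-options-Lstar⁻ {b} {x} {y} o with ∈-options⁻ (Lstar (suc b)) o
... | _ , here refl , x'∈ , y'∈ =
  subst (LstarMove _ x y _) (sym (trans (∈-addℕ⁺ y 0 y'∈) (+-identityʳ y))) (horizontal (∈-addℕ⁻ x'∈))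
... | _ , there (here refl) , x'∈ , y'∈ =
  subst (λ x' → LstarMove _ x y x' _) (sym (trans (∈-addℕ⁺ x 0 x'∈) (+-identityʳ x))) (vertical (∈-addℕ⁻ y'∈))
... | _ , there (there m∈) , x'∈ , y'∈ with ∈-map⁻ _ m∈
...   | k , k<b , refl rewrite ∈-addℕ⁺ y (suc k) y'∈ = diagonal z<s (∈-upTo⁻ k<b) (∈-addℕ⁻ x'∈)

∈-options-Lstar⁺ : ∀ {b x y x' y'} → LstarMove (suc b) x y x' y' → (x' , y') ∈ options (Lstar (suc b)) x y
∈-options-Lstar⁺ {b} {x} {y} (horizontal x'+b) =
  ∈-options⁺ (Lstar (suc b)) (here refl) (addℕ⁻-≡ x'+b) (cong [_] (+-identityʳ y))
∈-options-Lstar⁺ {b} {x} {y} (vertical y'+b) =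
  ∈-options⁺ (Lstar (suc b)) (there (here refl)) (cong [_] (+-identityʳ x)) (addℕ⁻-≡ y'+b)
∈-options-Lstar⁺ {b} (diagonal {k = suc k} _ k≤b x'+k) =
  ∈-options⁺ (Lstar (suc b)) (there (there (∈-map⁺ _ (∈-upTo⁺ k≤b)))) (addℕ⁻-≡ x'+k) refl

measure-decreasing : ∀ {b x y x' y'} → LstarMove (suc b) x y x' y' → measure x' y' < measure x y
measure-decreasing {b} {y = y} {x'} (horizontal refl) =
  +-mono-≤-< (*-mono-≤ x'+y≤x+y (+-monoˡ-≤ 2 x'+y≤x+y)) x'<x
  where
  x'<x : x' < x' + suc b
  x'<x = m<m+n x' z<s
  x'+y≤x+y : x' + y ≤ x' + suc b + y
  x'+y≤x+y = +-monoˡ-≤ y (<⇒≤ x'<x)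
measure-decreasing {b} {x} {y' = y'} (vertical refl) =
  +-mono-<-≤ (*-mono-< x+y'<x+y (+-monoˡ-< 2 x+y'<x+y)) ≤-refl
  where
  x+y'<x+y : x + y' < x + (y' + suc b)
  x+y'<x+y = +-monoʳ-< x (m<m+n y' z<s)
measure-decreasing {y = y} {x'} (diagonal {k = k} 1≤k _ refl)
  rewrite +-comm y k | sym (+-assoc x' k y) =
  +-monoʳ-< ((x' + k + y) * (x' + k + y + 2)) (m<m+n x' 1≤k)

-- Binary digits, residues and rows

bit : Bool → ℕ
bit false = 0
bit true  = 1

-- Opaque, so that unification can read h and e off 2* h +bit e.
infix 8 2*_+bit_
opaque
  2*_+bit_ : ℕ → Bool → ℕ
  2* h +bit e = bit e + (h + h)

opaque
  unfolding 2*_+bit_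

  bit≤1 : ∀ e → bit e ≤ 1
  bit≤1 false = z≤n
  bit≤1 true  = s≤s z≤n

  bit-injective : ∀ {e e'} → bit e ≡ bit e' → e ≡ e'
  bit-injective {false} {false} _ = refl
  bit-injective {true}  {true}  _ = refl

  2*+bit-split : ∀ n → ∃₂ λ h e → n ≡ 2* h +bit e
  2*+bit-split zero = 0 , false , refl
  2*+bit-split (suc n) with 2*+bit-split n
  ... | h , false , refl = h , true , refl
  ... | h , true  , refl = suc h , false , cong suc (sym (+-suc h h))

  2*+bit-true : ∀ h → 2* h +bit true ≡ suc (2* h +bit false)
  2*+bit-true h = refl

  2*+bit-<-half : ∀ {h h'} e e' → h < h' → 2* h +bit e < 2* h' +bit e'
  2*+bit-<-half {h} {h'} e e' h<h' = begin-strict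
    bit e + (h + h)      ≤⟨ +-monoˡ-≤ (h + h) (bit≤1 e) ⟩
    suc (h + h)          <⟨ n<1+n (suc (h + h)) ⟩
    suc (suc (h + h))    ≡⟨ cong suc (sym (+-suc h h)) ⟩
    suc h + suc h        ≤⟨ +-mono-≤ h<h' h<h' ⟩
    h' + h'              ≤⟨ m≤n+m (h' + h') (bit e') ⟩
    bit e' + (h' + h')   ∎
    where open ≤-Reasoning

  2*+bit-injective : ∀ {h h' e e'} → 2* h +bit e ≡ 2* h' +bit e' → h ≡ h' × e ≡ e'
  2*+bit-injective {h} {h'} {e} {e'} eq with <-cmp h h'
  ... | tri< h<h' _ _ = contradiction eq (<⇒≢ (2*+bit-<-half e e' h<h'))
  ... | tri> _ _ h>h' = contradiction eq (≢-sym (<⇒≢ (2*+bit-<-half e' e h>h')))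
  ... | tri≈ _ refl _ = refl , bit-injective (+-cancelʳ-≡ (h + h) (bit e) (bit e') eq)

  2*+bit-≢-half : ∀ {h h' e e'} → h' ≢ h → 2* h' +bit e' ≢ 2* h +bit e
  2*+bit-≢-half {h} {h'} {e} {e'} h'≢h eq = h'≢h (proj₁ (2*+bit-injective {h'} {h} {e'} {e} eq))

  2*+bit-≢-not : ∀ {h e e'} → e' ≡ not e → 2* h +bit e' ≢ 2* h +bit e
  2*+bit-≢-not {h} {e} refl eq = not-¬ refl (sym (proj₂ (2*+bit-injective {h} {h} {not e} {e} eq)))

  2*+bit-<-cases : ∀ {h h' e t} → 2* h' +bit t < 2* h +bit e → h' < h ⊎ (h' ≡ h × t ≡ false × e ≡ true)
  2*+bit-<-cases {h} {h'} {e} {t} lt with <-cmp h' h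
  ... | tri< h'<h _ _ = inj₁ h'<h
  ... | tri> _ _ h'>h = contradiction lt (<⇒≯ (2*+bit-<-half e t h'>h))
  ... | tri≈ _ refl _ = inj₂ (refl , bits (+-cancelʳ-< (h + h) (bit t) (bit e) lt))
    where
    bits : ∀ {t e} → bit t < bit e → t ≡ false × e ≡ true
    bits {false} {true} _ = refl , refl
    bits {true}  {true} (s≤s ())

  2*+bit-+-same-half : ∀ {h d d' k} → 2* h +bit d' + k ≡ 2* h +bit d → 1 ≤ k →
                   k ≡ 1 × d ≡ true × d' ≡ false
  2*+bit-+-same-half {h} {d} {d'} {k} eq 1≤k = bits (+-cancelʳ-≡ (h + h) (bit d' + k) (bit d) regrouped) 1≤k
    where
    regrouped : bit d' + k + (h + h) ≡ bit d + (h + h)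
    regrouped = trans (swap (bit d') k (h + h)) eq
      where
      swap : ∀ m n o → m + n + o ≡ m + o + n
      swap = solve-∀
    bits : ∀ {d d' k} → bit d' + k ≡ bit d → 1 ≤ k → k ≡ 1 × d ≡ true × d' ≡ false
    bits {true}  {false} refl _ = refl , refl , refl
    bits {false} {false} refl ()
    bits {false} {true}  ()
    bits {true}  {true}  eq (s≤s _) = contradiction (suc-injective eq) λ ()

  2*+bit-<-half⇒+2≤ : ∀ {h h' d} → h' < h → 2 + (2* h' +bit false) ≤ 2* h +bit d
  2*+bit-<-half⇒+2≤ {h} {h'} {d} h'<h = 2*+bit-<-half true d h'<h

  2*+bit-+2≤⇒<-half : ∀ {h h' d d'} → 2* h +bit d + 2 ≤ 2* h' +bit d' → h < h'
  2*+bit-+2≤⇒<-half {h} {h'} {d} {d'} le = ≰⇒> λ h'≤h → <-irrefl refl (begin-strict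
    bit d' + (h' + h')    ≤⟨ +-mono-≤ (bit≤1 d') (+-mono-≤ h'≤h h'≤h) ⟩
    1 + (h + h)           <⟨ n<1+n (suc (h + h)) ⟩
    2 + (h + h)           ≤⟨ +-monoˡ-≤ (h + h) (m≤n+m 2 (bit d)) ⟩
    bit d + 2 + (h + h)   ≡⟨ swap (bit d) (h + h) ⟩
    bit d + (h + h) + 2   ≤⟨ le ⟩
    bit d' + (h' + h')    ∎)
    where
    open ≤-Reasoning
    swap : ∀ m n → m + 2 + n ≡ m + n + 2
    swap = solve-∀

[q*n+r]+n≡[1+q]*n+r : ∀ q n r → q * n + r + n ≡ suc q * n + r
[q*n+r]+n≡[1+q]*n+r = solve-∀

Residue : ℕ → ℕ → ℕ → Set
Residue P x r = r < P × ∃ λ q → x ≡ q * P + r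

residue-exists : ∀ P .{{_ : NonZero P}} x → ∃ (Residue P x)
residue-exists P x = x % P , m%n<n x P , x / P , trans (m≡m%n+[m/n]*n x P) (+-comm (x % P) (x / P * P))

residue-+ : ∀ {P x r} → Residue P x r → Residue P (x + P) r
residue-+ {P} {r = r} (r<P , q , refl) = r<P , suc q , [q*n+r]+n≡[1+q]*n+r q P r

residue-sub : ∀ {P x r j ℓ} → Residue P x r → j + ℓ ≡ r → ∃ λ x₀ → x₀ + j ≡ x × Residue P x₀ ℓ
residue-sub {P} {j = j} {ℓ} (r<P , q , refl) refl =
  q * P + ℓ , trans (+-assoc (q * P) ℓ j) (cong (q * P +_) (+-comm ℓ j)) ,
  ≤-<-trans (m≤n+m ℓ j) r<P , q , refl

m+k≡n+[k+o]⇒m≡n+o : ∀ {m k n o s} → m + k ≡ n + s → k + o ≡ s → m ≡ n + o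
m+k≡n+[k+o]⇒m≡n+o {m} {k} {n} {o} eq refl = +-cancelʳ-≡ k m (n + o) (trans eq (regroup n k o))
  where
  regroup : ∀ n k o → n + (k + o) ≡ n + o + k
  regroup = solve-∀

residue-suc : ∀ {P x r} → Residue P x r → suc r < P → Residue P (suc x) (suc r)
residue-suc {P} {r = r} (_ , q , refl) 1+r<P = 1+r<P , q , sym (+-suc (q * P) r)

residue-step : ∀ {P x r x' k} → Residue P x r → x' + k ≡ x → k ≤ P →
               ∃ λ r' → Residue P x' r' × (r' + k ≡ r ⊎ r' + k ≡ P + r)
residue-step {r = r} {k = k} (r<P , q , refl) x'+k≡x k≤P with k ≤? r
... | yes k≤r with m≤n⇒∃[o]m+o≡n k≤r
...   | r' , k+r'≡r =
  r' , (≤-<-trans (subst (r' ≤_) k+r'≡r (m≤n+m r' k)) r<P , q , m+k≡n+[k+o]⇒m≡n+o x'+k≡x k+r'≡r) ,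
  inj₁ (trans (+-comm r' k) k+r'≡r)
residue-step {x' = x'} {k} (_ , zero , refl) x'+k≡x _ | no k≰r =
  contradiction (subst (k ≤_) x'+k≡x (m≤n+m k x')) k≰r
residue-step {P} {r = r} {k = k} (_ , suc q , refl) x'+k≡x k≤P | no k≰r
  with m≤n⇒∃[o]m+o≡n (≤-trans k≤P (m≤m+n P r))
... | r' , k+r'≡P+r =
  r' , (r'<P , q , m+k≡n+[k+o]⇒m≡n+o (trans x'+k≡x (unfold q P r)) k+r'≡P+r) , inj₂ (trans (+-comm r' k) k+r'≡P+r)
  where
  unfold : ∀ q P r → suc q * P + r ≡ q * P + (P + r)
  unfold = solve-∀
  r'<P : r' < P
  r'<P = +-cancelʳ-< k r' P (subst (_< P + k) (trans (sym k+r'≡P+r) (+-comm k r'))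
                                                 (+-monoʳ-< P (≰⇒> k≰r)))

data RowPosition (b s : ℕ) : Bool → Set where
  top   : suc s ≡ b → RowPosition b s true
  inner : suc s < b → RowPosition b s false

rowPosition : ∀ {b s} → s < b → ∃ (RowPosition b s)
rowPosition s<b with m≤n⇒m<n∨m≡n s<b
... | inj₁ 1+s<b = false , inner 1+s<b
... | inj₂ 1+s≡b = true , top 1+s≡b

rowPosition-< : ∀ {b s t} → RowPosition b s t → s < b
rowPosition-< (top 1+s≡b)   = ≤-reflexive 1+s≡b
rowPosition-< (inner 1+s<b) = <⇒≤ 1+s<b

odd : ℕ → Bool
odd zero    = false
odd (suc n) = not (odd n)

Row : ℕ → ℕ → Bool → Bool → Set
Row b y c t = ∃₂ λ q s → y ≡ q * b + s × c ≡ odd q × RowPosition b s t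

row-exists : ∀ b .{{_ : NonZero b}} y → ∃₂ (Row b y)
row-exists b y with rowPosition (m%n<n y b)
... | t , position = odd (y / b) , t , y / b , y % b ,
                     trans (m≡m%n+[m/n]*n y b) (+-comm (y % b) (y / b * b)) , refl , position

row-suc : ∀ {b y c t} → Row b y c t → ∃ (Row b (suc y) (t xor c))
row-suc (q , s , refl , refl , top refl) with rowPosition {suc s} {0} (s≤s z≤n)
... | t' , position = t' , suc q , 0 , next-block q s , refl , position
  where
  next-block : ∀ q s → suc (q * suc s + s) ≡ suc q * suc s + 0
  next-block = solve-∀
row-suc (q , s , refl , refl , inner 1+s<b) with rowPosition 1+s<b
... | t' , position = t' , q , suc s , sym (+-suc (q * _) s) , refl , position

row-+ : ∀ {b y c t} → Row b y c t → Row b (y + b) (not c) t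
row-+ {b} (q , s , refl , refl , position) = suc q , s , [q*n+r]+n≡[1+q]*n+r q b s , refl , position

row-+⁻ : ∀ {b y c t} → Row b (y + b) c t → Row b y (not c) t
row-+⁻ {b} {y} (zero , s , y+b≡s , _ , position) =
  contradiction (subst (b ≤_) y+b≡s (m≤n+m b y)) (<⇒≱ (rowPosition-< position))
row-+⁻ {b} {y} (suc q , s , y+b≡ , refl , position) =
  q , s , +-cancelʳ-≡ b y (q * b + s) (trans y+b≡ (sym ([q*n+r]+n≡[1+q]*n+r q b s))) ,
  not-involutive (odd q) , position

row-odd⇒∃[y']y'+b≡y : ∀ {b y t} → Row b y true t → ∃ λ y' → y' + b ≡ y
row-odd⇒∃[y']y'+b≡y (zero , _ , _ , () , _)
row-odd⇒∃[y']y'+b≡y {b} (suc q , s , refl , _ , _) = q * b + s , [q*n+r]+n≡[1+q]*n+r q b s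

-- The Sprague–Grundy function of L*(b,b,b)

lowBit : Bool → Bool → Bool → Bool
lowBit d c t = (d ∧ not t) xor c

lowBit-flip : ∀ d c t → lowBit d (not c) t ≡ not (lowBit d c t)
lowBit-flip d c t = sym (not-distribʳ-xor (d ∧ not t) c)

lowBit-step : ∀ c t t' → lowBit false (t xor c) t' ≡ not (lowBit true c t)
lowBit-step c t t' = trans (sym (not-involutive (t xor c))) (cong not (not-distribˡ-xor t c))

module LstarGrundy (b₀ : ℕ) where

  b : ℕ
  b = 2 + b₀

  P : ℕ
  P = b + 2

  column-step : ∀ {x h d x' k} → Residue P x (2* h +bit d) → x' + k ≡ x → 1 ≤ k → k ≤ b →
                ∃₂ λ h' d' → Residue P x' (2* h' +bit d') × (h' ≡ h → k ≡ 1 × d ≡ true × d' ≡ false)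
  column-step {h = h} {d} {k = k} column x'+k≡x 1≤k k≤b
    with residue-step column x'+k≡x (≤-trans k≤b (m≤m+n b 2))
  ... | r' , column' , step with 2*+bit-split r'
  ... | h' , d' , refl = h' , d' , column' , same-half step
    where
    same-half : 2* h' +bit d' + k ≡ 2* h +bit d ⊎ 2* h' +bit d' + k ≡ P + 2* h +bit d →
                h' ≡ h → k ≡ 1 × d ≡ true × d' ≡ false
    same-half (inj₁ r'+k≡r) refl = 2*+bit-+-same-half r'+k≡r 1≤k
    same-half (inj₂ r'+k≡P+r) h'≡h = contradiction h'≡h (>⇒≢ (2*+bit-+2≤⇒<-half r+2≤r'))
      where
      r+2≤r' : 2* h +bit d + 2 ≤ 2* h' +bit d'
      r+2≤r' = +-cancelʳ-≤ k _ _ (begin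
        2* h +bit d + 2 + k   ≤⟨ +-monoʳ-≤ (2* h +bit d + 2) k≤b ⟩
        2* h +bit d + 2 + b   ≡⟨ swap (2* h +bit d) b ⟩
        P + 2* h +bit d       ≡⟨ sym r'+k≡P+r ⟩
        2* h' +bit d' + k     ∎)
        where
        open ≤-Reasoning
        swap : ∀ r b → r + 2 + b ≡ b + 2 + r
        swap = solve-∀

  column-below : ∀ {x h d h'} → Residue P x (2* h +bit d) → h' < h →
                 ∃₂ λ j x₀ → 1 ≤ j × j ≤ b × x₀ + suc j ≡ x ×
                   Residue P x₀ (2* h' +bit false) × Residue P (suc x₀) (2* h' +bit true)
  column-below {h = h} {d} {h'} column@(r<P , _) h'<h
    with o , 2+ℓ+o≡r ← m≤n⇒∃[o]m+o≡n (2*+bit-<-half⇒+2≤ {d = d} h'<h)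
    with x₀ , x₀+j≡x , column₀ ← residue-sub column (trans (cong (2 +_) (+-comm o _)) 2+ℓ+o≡r) =
    1 + o , x₀ , s≤s z≤n , j≤b , x₀+j≡x , column₀ ,
    subst (Residue P (suc x₀)) (sym (2*+bit-true h')) (residue-suc column₀ 1+ℓ<P)
    where
    ℓ : ℕ
    ℓ = 2* h' +bit false
    1+ℓ<P : suc ℓ < P
    1+ℓ<P = ≤-<-trans (≤-trans (n≤1+n (suc ℓ)) (m≤m+n (2 + ℓ) o)) (subst (_< P) (sym 2+ℓ+o≡r) r<P)
    j≤b : 1 + o ≤ b
    j≤b = ≤-pred (≤-pred (begin
      3 + o          ≤⟨ +-monoʳ-≤ 3 (m≤n+m o ℓ) ⟩
      3 + (ℓ + o)    ≡⟨ cong suc 2+ℓ+o≡r ⟩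
      suc (2* h +bit d)  ≤⟨ r<P ⟩
      b + 2          ≡⟨ +-comm b 2 ⟩
      2 + b          ∎))
      where open ≤-Reasoning

  data Formula (x y : ℕ) : ℕ → Set where
    formula : ∀ {h d c t} → Residue P x (2* h +bit d) → Row b y c t → Formula x y (2* h +bit lowBit d c t)

  formula-avoided : ∀ {x y v x' y'} → Formula x y v → LstarMove b x y x' y' →
                    ∃ λ v' → v' ≢ v × Formula x' y' v'
  formula-avoided (formula column row) (horizontal x'+b≡x)
    with column-step column x'+b≡x (s≤s z≤n) ≤-refl
  ... | h' , d' , column' , same-half =
    _ , 2*+bit-≢-half (λ h'≡h → b≢1 (proj₁ (same-half h'≡h))) , formula column' row
    where
    b≢1 : b ≢ 1
    b≢1 ()
  formula-avoided (formula {d = d} {c} {t} column row) (vertical refl) =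
    _ , 2*+bit-≢-not (lowBit-flip d c t) , formula column (row-+⁻ row)
  formula-avoided {y = y} (formula {h} column row) (diagonal {k = k} 1≤k k≤b x'+k≡x)
    with column-step column x'+k≡x 1≤k k≤b
  ... | h' , d' , column' , same-half with h' ≟ h
  ...   | no h'≢h with row-exists b (y + k)
  ...     | _ , _ , row' = _ , 2*+bit-≢-half h'≢h , formula column' row'
  formula-avoided {y = y} (formula {h} {c = c} {t} column row) (diagonal _ _ _)
      | h , d' , column' , same-half | yes refl with same-half refl | row-suc row
  ... | refl , refl , refl | t' , row' =
    _ , 2*+bit-≢-not (lowBit-step c t t') , formula column' (subst (λ y' → Row b y' (t xor c) t') (+-comm 1 y) row')

  Reaches : ℕ → ℕ → ℕ → Set
  Reaches x y v = ∃₂ λ x' y' → LstarMove b x y x' y' × Formula x' y' v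

  reaches-both-bits : ∀ {x y h e} → Reaches x y (2* h +bit e) → Reaches x y (2* h +bit not e) →
                      ∀ e' → Reaches x y (2* h +bit e')
  reaches-both-bits {e = false} reach _     false = reach
  reaches-both-bits {e = false} _     reach true  = reach
  reaches-both-bits {e = true}  _     reach false = reach
  reaches-both-bits {e = true}  reach _     true  = reach

  reaches-lower-half : ∀ {x y h d c t h'} → Residue P x (2* h +bit d) → Row b y c t → h' < h →
                       ∀ e → Reaches x y (2* h' +bit e)
  reaches-lower-half {y = y} {c = c} {t} {h'} column row h'<h
    with j , x₀ , 1≤j , j≤b , x₀+1+j≡x , column₀ , column₁ ← column-below column h'<h
    with suc j ≤? b
  ... | yes 1+j≤b with c₁ , t₁ , row₁ ← row-exists b (y + j) with t₀ , row₀ ← row-suc row₁ =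
    reaches-both-bits
      (suc x₀ , y + j , diagonal 1≤j j≤b (trans (sym (+-suc x₀ j)) x₀+1+j≡x) , formula column₁ row₁)
      (subst (λ e → Reaches _ y (2* h' +bit e)) (lowBit-step c₁ t₁ t₀)
        (x₀ , y + suc j , diagonal (s≤s z≤n) 1+j≤b x₀+1+j≡x ,
         formula column₀ (subst (λ y' → Row b y' (t₁ xor c₁) t₀) (sym (+-suc y j)) row₀)))
  ... | no 1+j≰b with refl ← ≤-antisym j≤b (≤-pred (≰⇒> 1+j≰b)) =
    reaches-both-bits
      (suc x₀ , y , horizontal (trans (sym (+-suc x₀ j)) x₀+1+j≡x) , formula column₁ row)
      (subst (λ e → Reaches _ y (2* h' +bit e)) (lowBit-flip true c t)
        (suc x₀ , y + j , diagonal 1≤j ≤-refl (trans (sym (+-suc x₀ j)) x₀+1+j≡x) ,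
         formula column₁ (row-+ row)))

  reaches-same-half : ∀ {x y h d c t} → Residue P x (2* h +bit d) → Row b y c t → lowBit d c t ≡ true →
                      Reaches x y (2* h +bit false)
  reaches-same-half {y = y} {h} {true} {c} {t} column row odd
    with x₀ , x₀+1≡x , column₀ ← residue-sub column (sym (2*+bit-true h))
    with t' , row' ← row-suc row =
    subst (λ e → Reaches _ y (2* h +bit e)) (trans (lowBit-step c t t') (cong not odd))
      (x₀ , y + 1 , diagonal (s≤s z≤n) (s≤s z≤n) x₀+1≡x ,
       formula column₀ (subst (λ y' → Row b y' (t xor c) t') (+-comm 1 y) row'))
  reaches-same-half {x} {d = false} {t = t} column row refl
    with y' , y'+b≡y ← row-odd⇒∃[y']y'+b≡y row =
    x , y' , vertical y'+b≡y ,
    formula column (row-+⁻ (subst (λ y → Row b y true t) (sym y'+b≡y) row))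

  formula-reached : ∀ {x y v u} → Formula x y v → u < v → Reaches x y u
  formula-reached {u = u} (formula column row) u<v with h' , e , refl ← 2*+bit-split u
    with 2*+bit-<-cases u<v
  ... | inj₁ h'<h = reaches-lower-half column row h'<h e
  ... | inj₂ (refl , refl , odd) = reaches-same-half column row odd

  SGL-≡ : ∀ {x y v} → Formula x y v → SGL b x y ≡ v
  SGL-≡ = GrundyCharacterisation.sgFuel-≡ (Lstar b) measure
            (λ {x} {y} o → measure-decreasing (∈-options-Lstar⁻ {x = x} {y} o)) Formula
            (λ {x} {y} xy↦v o → formula-avoided xy↦v (∈-options-Lstar⁻ {x = x} {y} o))
            (λ xy↦v u<v → map₂ (map₂ (map₁ ∈-options-Lstar⁺)) (formula-reached xy↦v u<v))
            ≤-refl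

  formula-exists : ∀ x y → ∃ (Formula x y)
  formula-exists x y
    with r , column ← residue-exists P x
    with h , d , refl ← 2*+bit-split r
    with c , t , row ← row-exists b y = _ , formula column row

  SGL-periodic : ∀ x y → SGL b (x + P) y ≡ SGL b x y
  SGL-periodic x y with _ , xy↦v@(formula column row) ← formula-exists x y =
    trans (SGL-≡ (formula (residue-+ column) row)) (sym (SGL-≡ xy↦v))

  SGL-bottom-row : ∀ {x r} → Residue P x r → SGL b x 0 ≡ r
  SGL-bottom-row {r = r} column with h , d , refl ← 2*+bit-split r =
    trans (SGL-≡ (formula column bottom-row)) (cong (2* h +bit_) (trans (xor-identityʳ _) (∧-identityʳ d)))
    where
    bottom-row : Row b 0 false false
    bottom-row = 0 , 0 , refl , refl , inner (s≤s (s≤s z≤n))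

  SGL-aperiodic : ∀ q → 0 < q → q < P → ¬ IsHorizPeriod (SGL b) q
  SGL-aperiodic q 0<q q<P (N , periodic) = >⇒≢ 0<q (begin
    q                    ≡⟨ SGL-bottom-row (q<P , N , refl) ⟨
    SGL b (N * P + q) 0  ≡⟨ periodic (N * P) 0 (m≤m*n N P) ⟩
    SGL b (N * P) 0      ≡⟨ SGL-bottom-row (z<s , N , sym (+-identityʳ (N * P))) ⟩
    0                    ∎)
    where open ≡-Reasoning

mainTheorem3 : (b : ℕ) → 2 ≤ b → HorizPeriodComponent (SGL b) (b + 2)
mainTheorem3 (suc (suc b₀)) (s≤s (s≤s z≤n)) = z<s , (0 , λ x y _ → SGL-periodic x y) , SGL-aperiodic
  where open LstarGrundy b₀
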